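{- Let $N_f$ be an odd positive integer and put $\tilde N_f = N_f + 1$. Consider a sequence of networks $G_1, G_2, \dots$ with node counts $N_k = N_{k-1}+1$ for $k \ge 2$, where $N_f < N_k - 2$ for all $k$. Together with the networks, maintain an auxiliary cycle $C_k$ whose node set is the node set of $G_k$ ($C_k$ is bookkeeping only; its links are not necessarily links of $G_k$). Let $G_1$ be the network on the $N_1$ nodes of $C_1$ in which every node is linked to every node within distance $\tilde N_f/2$ along $C_1$. For $k \ge 2$, obtain $G_k$ from $G_{k-1}$ as follows: (i) form $C_k$ from $C_{k-1}$ by inserting the new node between any two adjacent nodes of $C_{k-1}$; (ii) link the new node to all nodes within distance $\tilde N_f/2$ of it along $C_k$; no other links are added or removed. Then $G_i$ is a subnetwork of $G_j$ for all $i \le j$, every $G_k$ is $N_f$-robust, and the number of links $L_k$ of $G_k$ satisfies $L_k \le N_k(N_f+1)$.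
   Context: A network is a finite simple undirected graph; links are edges. For an integer $N_f$, a network $G$ is $N_f$-robust if for every set $S$ of $N_f$ nodes of $G$, the network obtained by deleting the nodes of $S$ and their incident links is connected. The distance along a cycle between two of its nodes is the number of edges of the shorter of the two paths in the cycle between them. -}

module Defs where

open import Data.Nat.Base
open import Data.Bool.Base using (Bool; true; false; _∧_; _∨_; if_then_else_; not)
open import Data.Fin.Base using (Fin; toℕ)
open import Data.List.Base using (List; length; upTo; map)
open import Data.Nat.ListAction using (sum)
import Data.Nat.Properties
import Data.Fin.Base
import Relation.Binary.PropositionalEquality
open import Data.List.Membership.Propositional using (_∉_)
open import Data.List.Relation.Unary.All using (All)
open import Data.List.Relation.Unary.Unique.Propositional using (Unique)
open import Data.Product.Base using (Σ; _×_)
open import Relation.Binary.PropositionalEquality using (_≡_)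

-- Nf is odd (and hence positive).
Odd : ℕ → Set
Odd n = Σ ℕ λ m → n ≡ 2 * m + 1

-- Networks.  A network with n nodes has node set {0, …, n-1} (natural
-- number labels) and a Bool-valued adjacency relation (links).

record Network : Set where
  field
    size : ℕ
    adj  : ℕ → ℕ → Bool
open Network public

-- Links are unordered pairs {a,b}, a < b < size, with adj a b = true.
linkCount : Network → ℕ
linkCount G =
  sum (map (λ b → sum (map (λ a → if adj G a b then 1 else 0) (upTo b)))
           (upTo (size G)))

Subnetwork : Network → Network → Set
Subnetwork G H =
  (size G ≤ size H) ×
  (∀ a b → a < size G → b < size G → adj G a b ≡ true → adj H a b ≡ true)

data WalkAvoiding (G : Network) (S : List ℕ) : ℕ → ℕ → Set where
  here : ∀ {a} → WalkAvoiding G S a a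
  step : ∀ {a c b} → adj G a c ≡ true → c < size G → c ∉ S →
         WalkAvoiding G S c b → WalkAvoiding G S a b

ConnectedWithout : Network → List ℕ → Set
ConnectedWithout G S =
  ∀ a b → a < size G → b < size G → a ∉ S → b ∉ S → WalkAvoiding G S a b

Robust : ℕ → Network → Set
Robust Nf G =
  (S : List ℕ) → Unique S → length S ≡ Nf → All (λ v → v < size G) S →
  ConnectedWithout G S

cycDist : ℕ → ℕ → ℕ → ℕ
cycDist n x y = ∣ x - y ∣ ⊓ (n ∸ ∣ x - y ∣)

-- State of the construction: the network together with the auxiliary
-- cycle C, represented by the position (0 … size-1) of each node on C.
record State : Set where
  field
    net : Network
    pos : ℕ → ℕ
open State public

radius : ℕ → ℕ
radius Nf = (suc Nf) / 2

within : ℕ → ℕ → ℕ → ℕ → Bool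
within Nf n x y = cycDist n x y ≤ᵇ radius Nf

initial : ℕ → ℕ → State
initial Nf N1 = record
  { net = record
      { size = N1
      ; adj  = λ a b → (a <ᵇ N1) ∧ (b <ᵇ N1) ∧ not (a ≡ᵇ b) ∧ within Nf N1 a b }
  ; pos = λ v → v }

-- One growth step: the new node has label n = size; it is inserted in the
-- cycle between the nodes at positions p and p+1 (mod n), i.e. it gets
-- position p+1 and old nodes at positions > p are shifted by one.
grow : ℕ → (s : State) → Fin (size (net s)) → State
grow Nf s p = record
  { net = record { size = suc n ; adj = adj' }
  ; pos = pos' }
  where
  n = size (net s)
  q = toℕ p
  pos' : ℕ → ℕ
  pos' v = if v ≡ᵇ n then suc q
           else (if pos s v ≤ᵇ q then pos s v else suc (pos s v))
  near : ℕ → ℕ → Bool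
  near a b = within Nf (suc n) (pos' a) (pos' b)
  adj' : ℕ → ℕ → Bool
  adj' a b = adj (net s) a b
           ∨ ((a ≡ᵇ n) ∧ (b <ᵇ n) ∧ near a b)
           ∨ ((b ≡ᵇ n) ∧ (a <ᵇ n) ∧ near a b)

-- The sequence: construction Nf N1 ins k is (G_{k+1}, C_{k+1}), with
-- N1 + k nodes; ins k is the insertion position used to build step k+2.
mutual
  construction : (Nf N1 : ℕ) → ((k : ℕ) → Fin (N1 + k)) → ℕ → State
  construction Nf N1 ins zero = initial Nf N1
  construction Nf N1 ins (suc k) =
    grow Nf (construction Nf N1 ins k) (castIns Nf N1 ins k)

  castIns : (Nf N1 : ℕ) → (ins : (k : ℕ) → Fin (N1 + k)) → (k : ℕ) →
            Fin (size (net (construction Nf N1 ins k)))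
  castIns Nf N1 ins k = Data.Fin.Base.cast (sizeEq Nf N1 ins k) (ins k)

  sizeEq : (Nf N1 : ℕ) → (ins : (k : ℕ) → Fin (N1 + k)) → (k : ℕ) →
           N1 + k ≡ size (net (construction Nf N1 ins k))
  sizeEq Nf N1 ins zero = Data.Nat.Properties.+-identityʳ N1
  sizeEq Nf N1 ins (suc k) = Relation.Binary.PropositionalEquality.trans
    (Data.Nat.Properties.+-suc N1 k)
    (Relation.Binary.PropositionalEquality.cong suc (sizeEq Nf N1 ins k))

G : (Nf N1 : ℕ) → ((k : ℕ) → Fin (N1 + k)) → ℕ → Network
G Nf N1 ins k = net (construction Nf N1 ins k)

{-# OPTIONS --safe #-}
-- Each G_k keeps an invariant: its nodes are in bijection with the positions 0, …, N_k − 1 of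
-- the cycle C_k, and any two nodes within distance r = (N_f + 1)/2 along C_k are linked.
-- Inserting a node moves no two old nodes closer along the cycle, and the new node is linked to
-- every node within r of it, so the invariant persists, while links are only ever added.
-- For robustness, the two arcs of C_k between surviving nodes a and b together contain at most
-- N_f = 2r − 1 deleted nodes, so one of them contains fewer than r; walking along that arc, any
-- r consecutive nodes include a surviving one, and nodes at most r apart are linked.
-- For the link count, at most 2r = N_f + 1 nodes lie within distance r of a given position, so
-- G_1 has at most N_1 (N_f + 1) links and each growth step adds at most N_f + 1.

module Submission where

open import Defs
open import Data.Nat.Base
open import Data.Nat.Properties
open import Data.Nat.DivMod using (m*n/n≡m)
open import Data.Nat.ListAction using (sum)
open import Data.Nat.ListAction.Properties using (sum-++)
open import Data.Bool.Base using (Bool; true; false; _∧_; _∨_; if_then_else_; not; T)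
open import Data.Bool.Properties using (∨-comm; ∨-identityʳ; ∨-zeroʳ)
open import Data.List.Base using (List; []; _∷_; [_]; _++_; length; upTo; map)
open import Data.List.Properties using (map-++; upTo-∷ʳ)
open import Data.List.Membership.Propositional using (_∈_; _∉_)
open import Data.List.Membership.DecPropositional _≟_ using (_∈?_)
open import Data.List.Relation.Unary.Any using (here; there)
open import Data.Fin.Base using (Fin; toℕ)
open import Data.Fin.Properties using (toℕ<n)
open import Data.Product.Base using (Σ; _×_; _,_; proj₁; proj₂)
open import Data.Sum.Base using (_⊎_; inj₁; inj₂; [_,_]′)
open import Data.Empty using (⊥-elim)
open import Relation.Nullary using (¬_; Dec; yes; no)
open import Relation.Binary.PropositionalEquality
  using (_≡_; _≢_; refl; sym; trans; cong; subst; subst₂; module ≡-Reasoning)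
open import Function.Base using (_∘′_)
open import Algebra.Properties.CommutativeSemigroup +-commutativeSemigroup using (interchange)

∧-elim : ∀ {a b} → (a ∧ b) ≡ true → a ≡ true × b ≡ true
∧-elim {true} {true} _ = refl , refl

∧-intro : ∀ {a b} → a ≡ true → b ≡ true → (a ∧ b) ≡ true
∧-intro refl refl = refl

∨-elim : ∀ {a b} → (a ∨ b) ≡ true → a ≡ true ⊎ b ≡ true
∨-elim {true} _ = inj₁ refl
∨-elim {false} e = inj₂ e

∨-introˡ : ∀ {a} b → a ≡ true → (a ∨ b) ≡ true
∨-introˡ b refl = refl

∨-introʳ : ∀ a {b} → b ≡ true → (a ∨ b) ≡ true
∨-introʳ a refl = ∨-zeroʳ a

true⇒T : ∀ {b} → b ≡ true → T b
true⇒T refl = _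

T⇒true : ∀ {b} → T b → b ≡ true
T⇒true {true} _ = refl

≡ᵇ-true⇒≡ : ∀ {m n} → (m ≡ᵇ n) ≡ true → m ≡ n
≡ᵇ-true⇒≡ {m} {n} e = ≡ᵇ⇒≡ m n (true⇒T e)

≡ᵇ-refl : ∀ n → (n ≡ᵇ n) ≡ true
≡ᵇ-refl n = T⇒true (≡⇒≡ᵇ n n refl)

≢⇒≡ᵇ-false : ∀ {m n} → m ≢ n → (m ≡ᵇ n) ≡ false
≢⇒≡ᵇ-false {m} {n} m≢n with m ≡ᵇ n in e
... | false = refl
... | true = ⊥-elim (m≢n (≡ᵇ-true⇒≡ e))

≡ᵇ-sym : ∀ m n → (m ≡ᵇ n) ≡ (n ≡ᵇ m)
≡ᵇ-sym zero zero = refl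
≡ᵇ-sym zero (suc n) = refl
≡ᵇ-sym (suc m) zero = refl
≡ᵇ-sym (suc m) (suc n) = ≡ᵇ-sym m n

<ᵇ-true⇒< : ∀ {m n} → (m <ᵇ n) ≡ true → m < n
<ᵇ-true⇒< {m} {n} e = <ᵇ⇒< m n (true⇒T e)

<⇒<ᵇ-true : ∀ {m n} → m < n → (m <ᵇ n) ≡ true
<⇒<ᵇ-true m<n = T⇒true (<⇒<ᵇ m<n)

≥⇒<ᵇ-false : ∀ {m n} → n ≤ m → (m <ᵇ n) ≡ false
≥⇒<ᵇ-false {m} {n} n≤m with m <ᵇ n in e
... | false = refl
... | true = ⊥-elim (<⇒≱ (<ᵇ-true⇒< e) n≤m)

≤ᵇ-true⇒≤ : ∀ {m n} → (m ≤ᵇ n) ≡ true → m ≤ n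
≤ᵇ-true⇒≤ {m} {n} e = ≤ᵇ⇒≤ m n (true⇒T e)

≤⇒≤ᵇ-true : ∀ {m n} → m ≤ n → (m ≤ᵇ n) ≡ true
≤⇒≤ᵇ-true m≤n = T⇒true (≤⇒≤ᵇ m≤n)

>⇒≤ᵇ-false : ∀ {m n} → n < m → (m ≤ᵇ n) ≡ false
>⇒≤ᵇ-false {m} {n} n<m with m ≤ᵇ n in e
... | false = refl
... | true = ⊥-elim (<⇒≱ n<m (≤ᵇ-true⇒≤ e))

≤ᵇ-false⇒> : ∀ {m n} → (m ≤ᵇ n) ≡ false → n < m
≤ᵇ-false⇒> {m} {n} e with m ≤? n
... | yes m≤n with () ← trans (sym (≤⇒≤ᵇ-true m≤n)) e
... | no m≰n = ≰⇒> m≰n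

+<2*⇒⊎ : ∀ {m n r} → m + n < r + r → m < r ⊎ n < r
+<2*⇒⊎ {m} {n} {r} m+n<2r with m <? r
... | yes m<r = inj₁ m<r
... | no m≮r = inj₂ (+-cancelˡ-< r n r (≤-<-trans (+-monoˡ-≤ n (≮⇒≥ m≮r)) m+n<2r))

indicator : Bool → ℕ
indicator b = if b then 1 else 0

indicator-mono : ∀ {P Q} → (P ≡ true → Q ≡ true) → indicator P ≤ indicator Q
indicator-mono {false} _ = z≤n
indicator-mono {true} P⇒Q rewrite P⇒Q refl = ≤-refl

indicator-∨ : ∀ {P Q} → (P ≡ true → Q ≡ false) → indicator (P ∨ Q) ≡ indicator P + indicator Q
indicator-∨ {false} _ = refl
indicator-∨ {true} {false} _ = refl
indicator-∨ {true} {true} P⇒¬Q with () ← P⇒¬Q refl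

indicator-∨-≤ : ∀ {P A B} → (P ≡ true → A ≡ true ⊎ B ≡ true) →
  indicator P ≤ indicator A + indicator B
indicator-∨-≤ {false} _ = z≤n
indicator-∨-≤ {true} {true} _ = s≤s z≤n
indicator-∨-≤ {true} {false} {true} _ = s≤s z≤n
indicator-∨-≤ {true} {false} {false} P⇒A∨B with P⇒A∨B refl
... | inj₁ ()
... | inj₂ ()

sumUp : (ℕ → ℕ) → ℕ → ℕ
sumUp h n = sum (map h (upTo n))

sumUp-suc : ∀ h n → sumUp h (suc n) ≡ sumUp h n + h n
sumUp-suc h n = begin
  sum (map h (upTo (suc n)))          ≡⟨ cong (sum ∘′ map h) (upTo-∷ʳ n) ⟨
  sum (map h (upTo n ++ [ n ]))       ≡⟨ cong sum (map-++ h (upTo n) [ n ]) ⟩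
  sum (map h (upTo n) ++ [ h n ])     ≡⟨ sum-++ (map h (upTo n)) [ h n ] ⟩
  sumUp h n + (h n + 0)               ≡⟨ cong (sumUp h n +_) (+-identityʳ (h n)) ⟩
  sumUp h n + h n                     ∎
  where open ≡-Reasoning

sumUp-mono : ∀ h h' n → (∀ a → a < n → h a ≤ h' a) → sumUp h n ≤ sumUp h' n
sumUp-mono h h' zero _ = z≤n
sumUp-mono h h' (suc n) h≤h' rewrite sumUp-suc h n | sumUp-suc h' n =
  +-mono-≤ (sumUp-mono h h' n (λ a a<n → h≤h' a (m<n⇒m<1+n a<n))) (h≤h' n ≤-refl)

sumUp-cong : ∀ h h' n → (∀ a → a < n → h a ≡ h' a) → sumUp h n ≡ sumUp h' n
sumUp-cong h h' n h≡h' = ≤-antisym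
  (sumUp-mono h h' n (λ a a<n → ≤-reflexive (h≡h' a a<n)))
  (sumUp-mono h' h n (λ a a<n → ≤-reflexive (sym (h≡h' a a<n))))

sumUp-+ : ∀ h h' n → sumUp (λ a → h a + h' a) n ≡ sumUp h n + sumUp h' n
sumUp-+ h h' zero = refl
sumUp-+ h h' (suc n)
  rewrite sumUp-suc (λ a → h a + h' a) n | sumUp-suc h n | sumUp-suc h' n | sumUp-+ h h' n =
  interchange (sumUp h n) (sumUp h' n) (h n) (h' n)

sumUp-≤-* : ∀ h n c → (∀ a → a < n → h a ≤ c) → sumUp h n ≤ n * c
sumUp-≤-* h zero c _ = z≤n
sumUp-≤-* h (suc n) c h≤c rewrite sumUp-suc h n | +-comm c (n * c) =
  +-mono-≤ (sumUp-≤-* h n c (λ a a<n → h≤c a (m<n⇒m<1+n a<n))) (h≤c n ≤-refl)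

*-≤-sumUp : ∀ h n c → (∀ a → a < n → c ≤ h a) → n * c ≤ sumUp h n
*-≤-sumUp h zero c _ = z≤n
*-≤-sumUp h (suc n) c c≤h rewrite sumUp-suc h n | +-comm c (n * c) =
  +-mono-≤ (*-≤-sumUp h n c (λ a a<n → c≤h a (m<n⇒m<1+n a<n))) (c≤h n ≤-refl)

sumUp-≡0 : ∀ h n → (∀ a → a < n → h a ≡ 0) → sumUp h n ≡ 0
sumUp-≡0 h n h≡0 = n≤0⇒n≡0 (subst (sumUp h n ≤_) (*-zeroʳ n)
  (sumUp-≤-* h n 0 (λ a a<n → ≤-reflexive (h≡0 a a<n))))

count : {A : Set} → (A → Bool) → List A → ℕ
count P xs = sum (map (λ x → indicator (P x)) xs)

count-mono : ∀ {A : Set} (P Q : A → Bool) xs → (∀ x → P x ≡ true → Q x ≡ true) →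
  count P xs ≤ count Q xs
count-mono P Q [] _ = z≤n
count-mono P Q (x ∷ xs) P⇒Q = +-mono-≤ (indicator-mono (P⇒Q x)) (count-mono P Q xs P⇒Q)

count-∨ : ∀ {A : Set} (P Q : A → Bool) xs → (∀ x → P x ≡ true → Q x ≡ false) →
  count (λ x → P x ∨ Q x) xs ≡ count P xs + count Q xs
count-∨ P Q [] _ = refl
count-∨ P Q (x ∷ xs) disjoint rewrite indicator-∨ (disjoint x) | count-∨ P Q xs disjoint =
  interchange (indicator (P x)) (indicator (Q x)) (count P xs) (count Q xs)

count≤length : ∀ {A : Set} (P : A → Bool) xs → count P xs ≤ length xs
count≤length P [] = z≤n
count≤length P (x ∷ xs) = +-mono-≤ (indicator≤1 (P x)) (count≤length P xs)
  where
  indicator≤1 : ∀ b → indicator b ≤ 1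
  indicator≤1 false = z≤n
  indicator≤1 true = ≤-refl

count-disjoint≤length : ∀ {A : Set} (P Q : A → Bool) xs → (∀ x → P x ≡ true → Q x ≡ false) →
  count P xs + count Q xs ≤ length xs
count-disjoint≤length P Q xs disjoint =
  subst (_≤ length xs) (count-∨ P Q xs disjoint) (count≤length (λ x → P x ∨ Q x) xs)

∈⇒1≤count : ∀ {A : Set} (P : A → Bool) xs x → x ∈ xs → P x ≡ true → 1 ≤ count P xs
∈⇒1≤count P (y ∷ xs) x (here refl) Px rewrite Px = s≤s z≤n
∈⇒1≤count P (y ∷ xs) x (there x∈xs) Px = ≤-trans (∈⇒1≤count P xs x x∈xs Px) (m≤n+m _ _)

injective⇒fibre≤1 : ∀ (h : ℕ → ℕ) m p → (∀ a a' → a < m → a' < m → h a ≡ h a' → a ≡ a') →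
  sumUp (λ a → indicator (h a ≡ᵇ p)) m ≤ 1
injective⇒fibre≤1 h zero p _ = z≤n
injective⇒fibre≤1 h (suc m) p h-inj rewrite sumUp-suc (λ a → indicator (h a ≡ᵇ p)) m
  with h m ≡ᵇ p in hm≡p
... | true = ≤-reflexive (cong (_+ 1)
      (sumUp-≡0 _ m (λ a a<m → cong indicator (≢⇒≡ᵇ-false (ha≢p a a<m)))))
  where
  ha≢p : ∀ a → a < m → h a ≢ p
  ha≢p a a<m ha≡p =
    <⇒≢ a<m (h-inj a m (m<n⇒m<1+n a<m) ≤-refl (trans ha≡p (sym (≡ᵇ-true⇒≡ hm≡p))))
... | false = subst (_≤ 1) (sym (+-identityʳ _))
      (injective⇒fibre≤1 h m p (λ a a' a<m a'<m → h-inj a a' (m<n⇒m<1+n a<m) (m<n⇒m<1+n a'<m)))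

-- lo ≤ x < lo + m, unfolded so that a count over the range splits value by value.
inRange : ℕ → ℕ → ℕ → Bool
inRange lo zero x = false
inRange lo (suc m) x = inRange lo m x ∨ (x ≡ᵇ lo + m)

inRange⇒< : ∀ lo m x → inRange lo m x ≡ true → x < lo + m
inRange⇒< lo (suc m) x e with ∨-elim {inRange lo m x} e
... | inj₁ e' = <-≤-trans (inRange⇒< lo m x e') (+-monoʳ-≤ lo (n≤1+n m))
... | inj₂ e' = subst (_< lo + suc m) (sym (≡ᵇ-true⇒≡ e')) (+-monoʳ-< lo (n<1+n m))

inRange⇒≥ : ∀ lo m x → inRange lo m x ≡ true → lo ≤ x
inRange⇒≥ lo (suc m) x e with ∨-elim {inRange lo m x} e
... | inj₁ e' = inRange⇒≥ lo m x e'
... | inj₂ e' = subst (lo ≤_) (sym (≡ᵇ-true⇒≡ e')) (m≤m+n lo m)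

inRange-intro : ∀ lo m x → lo ≤ x → x < lo + m → inRange lo m x ≡ true
inRange-intro lo zero x lo≤x x<lo+0 = ⊥-elim (<⇒≱ x<lo+0 (subst (_≤ x) (sym (+-identityʳ lo)) lo≤x))
inRange-intro lo (suc m) x lo≤x x<lo+m+1
  with m≤n⇒m<n∨m≡n (≤-pred (subst (suc x ≤_) (+-suc lo m) x<lo+m+1))
... | inj₁ x<lo+m rewrite inRange-intro lo m x lo≤x x<lo+m = refl
... | inj₂ refl rewrite ≡ᵇ-refl (lo + m) = ∨-zeroʳ (inRange lo m (lo + m))

count-inRange : ∀ {A : Set} (g : A → ℕ) lo m xs →
  count (λ x → inRange lo m (g x)) xs ≡ sumUp (λ t → count (λ x → g x ≡ᵇ lo + t) xs) m
count-inRange g lo zero xs = count-false xs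
  where
  count-false : ∀ xs → count (λ _ → false) xs ≡ 0
  count-false [] = refl
  count-false (_ ∷ xs) = count-false xs
count-inRange g lo (suc m) xs = begin
  count (λ x → inRange lo m (g x) ∨ (g x ≡ᵇ lo + m)) xs
    ≡⟨ count-∨ (λ x → inRange lo m (g x)) (λ x → g x ≡ᵇ lo + m) xs
         (λ x e → ≢⇒≡ᵇ-false (<⇒≢ (inRange⇒< lo m (g x) e))) ⟩
  count (λ x → inRange lo m (g x)) xs + count (λ x → g x ≡ᵇ lo + m) xs
    ≡⟨ cong (_+ count (λ x → g x ≡ᵇ lo + m) xs) (count-inRange g lo m xs) ⟩
  sumUp (λ t → count (λ x → g x ≡ᵇ lo + t) xs) m + count (λ x → g x ≡ᵇ lo + m) xs
    ≡⟨ sumUp-suc (λ t → count (λ x → g x ≡ᵇ lo + t) xs) m ⟨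
  sumUp (λ t → count (λ x → g x ≡ᵇ lo + t) xs) (suc m) ∎
  where open ≡-Reasoning

-- Positions and distances on a cycle

compare-+ : ∀ x y → (Σ ℕ λ k → y ≡ x + k) ⊎ (Σ ℕ λ k → x ≡ y + suc k)
compare-+ zero y = inj₁ (y , refl)
compare-+ (suc x) zero = inj₂ (x , refl)
compare-+ (suc x) (suc y) with compare-+ x y
... | inj₁ (k , e) = inj₁ (k , cong suc e)
... | inj₂ (k , e) = inj₂ (k , cong suc e)

-- For c, y < M and z < 2M these are (y − c) mod M and z mod M: offset M c y is
-- the number of steps forward from position c to position y on a cycle of length M.
offset : ℕ → ℕ → ℕ → ℕ
offset M c y = if c ≤ᵇ y then y ∸ c else y + M ∸ c

wrap : ℕ → ℕ → ℕ
wrap M z = if z <ᵇ M then z else z ∸ M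

offset-+ : ∀ M x k → offset M x (x + k) ≡ k
offset-+ M x k rewrite ≤⇒≤ᵇ-true (m≤m+n x k) = m+n∸m≡n x k

offset-+suc : ∀ M y k → offset M (y + suc k) y ≡ M ∸ suc k
offset-+suc M y k rewrite >⇒≤ᵇ-false (m<m+n y (z<s {k})) = [m+n]∸[m+o]≡n∸o y M (suc k)

wrap-< : ∀ {M z} → z < M → wrap M z ≡ z
wrap-< z<M rewrite <⇒<ᵇ-true z<M = refl

wrap-≥ : ∀ {M z} → M ≤ z → wrap M z ≡ z ∸ M
wrap-≥ M≤z rewrite ≥⇒<ᵇ-false M≤z = refl

wrap-+< : ∀ M x t → x < M → t ≤ M → wrap M (x + t) < M
wrap-+< M x t x<M t≤M with x + t <? M
... | yes x+t<M rewrite wrap-< x+t<M = x+t<M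
... | no x+t≮M rewrite wrap-≥ (≮⇒≥ x+t≮M) =
  ≤-<-trans (≤-trans (∸-monoˡ-≤ M (+-monoʳ-≤ x t≤M)) (≤-reflexive (m+n∸n≡m x M))) x<M

offset-wrap : ∀ M x t → x < M → t < M → offset M x (wrap M (x + t)) ≡ t
offset-wrap M x t x<M t<M with x + t <? M
... | yes x+t<M rewrite wrap-< x+t<M = offset-+ M x t
... | no x+t≮M rewrite wrap-≥ (≮⇒≥ x+t≮M) = goal
  where
  w = x + t ∸ M
  w+M≡x+t : w + M ≡ x + t
  w+M≡x+t = m∸n+n≡m (≮⇒≥ x+t≮M)
  w<x : w < x
  w<x = +-cancelʳ-< M w x (subst (_< x + M) (sym w+M≡x+t) (+-monoʳ-< x t<M))
  goal : offset M x w ≡ t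
  goal rewrite >⇒≤ᵇ-false w<x | w+M≡x+t = m+n∸m≡n x t

wrap-offset : ∀ M x y → x < M → y < M → wrap M (x + offset M x y) ≡ y
wrap-offset M x y x<M y<M with compare-+ x y
... | inj₁ (k , refl) rewrite offset-+ M x k = wrap-< y<M
... | inj₂ (k , refl) rewrite offset-+suc M y k = begin
  wrap M (y + suc k + (M ∸ suc k)) ≡⟨ cong (wrap M) y+k+[M∸k]≡y+M ⟩
  wrap M (y + M)                   ≡⟨ wrap-≥ (m≤n+m M y) ⟩
  y + M ∸ M                        ≡⟨ m+n∸n≡m y M ⟩
  y                                ∎
  where
  open ≡-Reasoning
  y+k+[M∸k]≡y+M : y + suc k + (M ∸ suc k) ≡ y + M
  y+k+[M∸k]≡y+M = trans (+-assoc y (suc k) _)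
    (cong (y +_) (m+[n∸m]≡n (≤-trans (m≤n+m (suc k) y) (<⇒≤ x<M))))

offset< : ∀ M x y → x < M → y < M → offset M x y < M
offset< M x y x<M y<M with compare-+ x y
... | inj₁ (k , refl) rewrite offset-+ M x k = ≤-<-trans (m≤n+m k x) y<M
... | inj₂ (k , refl) rewrite offset-+suc M y k = ∸-monoʳ-< z<s (≤-trans (m≤n+m (suc k) y) (<⇒≤ x<M))

offset-injective : ∀ M x y y' → x < M → y < M → y' < M → offset M x y ≡ offset M x y' → y ≡ y'
offset-injective M x y y' x<M y<M y'<M eq = begin
  y                          ≡⟨ wrap-offset M x y x<M y<M ⟨
  wrap M (x + offset M x y)  ≡⟨ cong (λ o → wrap M (x + o)) eq ⟩
  wrap M (x + offset M x y') ≡⟨ wrap-offset M x y' x<M y'<M ⟩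
  y'                         ∎
  where open ≡-Reasoning

cycDist-sym : ∀ M x y → cycDist M x y ≡ cycDist M y x
cycDist-sym M x y rewrite ∣-∣-comm x y = refl

cycDist-+ : ∀ M p e → cycDist M p (p + e) ≤ e
cycDist-+ M p e = ≤-trans (m⊓n≤m _ _) (≤-reflexive (∣m-m+n∣≡n p e))

cycDist-+∸ : ∀ M p e → e ≤ M → cycDist M (p + (M ∸ e)) p ≤ e
cycDist-+∸ M p e e≤M = ≤-trans (m⊓n≤n _ _)
  (≤-reflexive (trans (cong (M ∸_) (trans (∣-∣-comm (p + (M ∸ e)) p) (∣m-m+n∣≡n p (M ∸ e))))
                      (m∸[m∸n]≡n e≤M)))

+-pos-≢ : ∀ p e → 0 < e → p ≢ p + e
+-pos-≢ p (suc e) _ p≡p+e = m+1+n≢m p (sym p≡p+e)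

wrap-near : ∀ M r x i d → x < M → 0 < d → d ≤ r → r < M →
  (wrap M (x + i) ≢ wrap M (x + (i + d))) × (cycDist M (wrap M (x + i)) (wrap M (x + (i + d))) ≤ r)
wrap-near M r x i d x<M 0<d d≤r r<M rewrite sym (+-assoc x i d) with x + i + d <? M | x + i <? M
... | yes u+d<M | _ rewrite wrap-< u+d<M | wrap-< (≤-<-trans (m≤m+n (x + i) d) u+d<M) =
  +-pos-≢ (x + i) d 0<d , ≤-trans (cycDist-+ M (x + i) d) d≤r
... | no u+d≮M | no u≮M
  rewrite wrap-≥ (≮⇒≥ u+d≮M) | wrap-≥ (≮⇒≥ u≮M) | +-∸-comm d (≮⇒≥ u≮M) =
  +-pos-≢ (x + i ∸ M) d 0<d , ≤-trans (cycDist-+ M (x + i ∸ M) d) d≤r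
... | no u+d≮M | yes u<M rewrite wrap-≥ (≮⇒≥ u+d≮M) | wrap-< u<M =
  subst (λ z → (z ≢ p) × (cycDist M z p ≤ r)) p+[M∸d]≡u
    ((λ e → +-pos-≢ p (M ∸ d) (m<n⇒0<n∸m (≤-<-trans d≤r r<M)) (sym e)) ,
     ≤-trans (cycDist-+∸ M p d d≤M) d≤r)
  where
  u = x + i
  p = u + d ∸ M
  d≤M : d ≤ M
  d≤M = ≤-trans d≤r (<⇒≤ r<M)
  p+[M∸d]≡u : p + (M ∸ d) ≡ u
  p+[M∸d]≡u = trans (sym (+-∸-assoc p d≤M))
    (trans (cong (_∸ d) (m∸n+n≡m (≮⇒≥ u+d≮M))) (m+n∸n≡m u d))

⊓≤⇒⊎ : ∀ {a b r} → a ⊓ b ≤ r → a ≤ r ⊎ b ≤ r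
⊓≤⇒⊎ {a} {b} a⊓b≤r with ⊓-sel a b
... | inj₁ e = inj₁ (subst (_≤ _) e a⊓b≤r)
... | inj₂ e = inj₂ (subst (_≤ _) e a⊓b≤r)

near⇒offset-inRange : ∀ M r c y → c < M → y < M → y ≢ c → r ≤ M → cycDist M y c ≤ r →
  inRange 1 r (offset M c y) ≡ true ⊎ inRange (M ∸ r) r (offset M c y) ≡ true
near⇒offset-inRange M r c y c<M y<M y≢c r≤M near with compare-+ c y
... | inj₁ (zero , refl) = ⊥-elim (y≢c (+-identityʳ c))
... | inj₁ (suc k , refl)
  rewrite offset-+ M c (suc k) | ∣-∣-comm (c + suc k) c | ∣m-m+n∣≡n c (suc k) with ⊓≤⇒⊎ near
...   | inj₁ k<r = inj₁ (inRange-intro 1 r (suc k) (s≤s z≤n) (s≤s k<r))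
...   | inj₂ M∸k≤r = inj₂ (inRange-intro (M ∸ r) r (suc k)
          (subst (M ∸ r ≤_) (m∸[m∸n]≡n (≤-trans (m≤n+m (suc k) c) (<⇒≤ y<M)))
            (∸-monoʳ-≤ M M∸k≤r))
          (subst (suc k <_) (sym (m∸n+n≡m r≤M)) (≤-<-trans (m≤n+m (suc k) c) y<M)))
near⇒offset-inRange M r c y c<M y<M y≢c r≤M near | inj₂ (k , refl)
  rewrite offset-+suc M y k | ∣m-m+n∣≡n y (suc k) with ⊓≤⇒⊎ near
... | inj₁ k<r = inj₂ (inRange-intro (M ∸ r) r (M ∸ suc k) (∸-monoʳ-≤ M k<r)
        (subst (M ∸ suc k <_) (sym (m∸n+n≡m r≤M))
          (∸-monoʳ-< z<s (≤-trans (m≤n+m (suc k) y) (<⇒≤ c<M)))))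
... | inj₂ M∸k≤r = inj₁ (inRange-intro 1 r (M ∸ suc k)
        (m<n⇒0<n∸m (≤-<-trans (m≤n+m (suc k) y) c<M)) (s≤s M∸k≤r))

near-count≤2r : ∀ M r c (g : ℕ → ℕ) m → c < M → r ≤ M → (∀ a → a < m → g a < M) →
  (∀ a a' → a < m → a' < m → g a ≡ g a' → a ≡ a') → (∀ a → a < m → g a ≢ c) →
  sumUp (λ a → indicator (cycDist M (g a) c ≤ᵇ r)) m ≤ r + r
near-count≤2r M r c g m c<M r≤M g<M g-inj g≢c = begin
  sumUp (λ a → indicator (cycDist M (g a) c ≤ᵇ r)) m
    ≤⟨ sumUp-mono _ _ m (λ a a<m → indicator-∨-≤ (λ near →
         near⇒offset-inRange M r c (g a) c<M (g<M a a<m) (g≢c a a<m) r≤M (≤ᵇ-true⇒≤ near))) ⟩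
  sumUp (λ a → indicator (inRange 1 r (o a)) + indicator (inRange (M ∸ r) r (o a))) m
    ≡⟨ sumUp-+ (λ a → indicator (inRange 1 r (o a))) (λ a → indicator (inRange (M ∸ r) r (o a))) m ⟩
  sumUp (λ a → indicator (inRange 1 r (o a))) m + sumUp (λ a → indicator (inRange (M ∸ r) r (o a))) m
    ≤⟨ +-mono-≤ (count-inRange≤r 1) (count-inRange≤r (M ∸ r)) ⟩
  r + r ∎
  where
  open ≤-Reasoning
  o : ℕ → ℕ
  o a = offset M c (g a)
  o-injective : ∀ a a' → a < m → a' < m → o a ≡ o a' → a ≡ a'
  o-injective a a' a<m a'<m e =
    g-inj a a' a<m a'<m (offset-injective M c (g a) (g a') c<M (g<M a a<m) (g<M a' a'<m) e)
  count-inRange≤r : ∀ lo → sumUp (λ a → indicator (inRange lo r (o a))) m ≤ r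
  count-inRange≤r lo = begin
    count (λ a → inRange lo r (o a)) (upTo m) ≡⟨ count-inRange o lo r (upTo m) ⟩
    sumUp (λ t → sumUp (λ a → indicator (o a ≡ᵇ lo + t)) m) r
      ≤⟨ sumUp-≤-* _ r 1 (λ t _ → injective⇒fibre≤1 o m (lo + t) o-injective) ⟩
    r * 1 ≡⟨ *-identityʳ r ⟩
    r ∎

shiftAfter : ℕ → ℕ → ℕ
shiftAfter q y = if y ≤ᵇ q then y else suc y

shiftAfter-view : ∀ q y → (y ≤ q × shiftAfter q y ≡ y) ⊎ (q < y × shiftAfter q y ≡ suc y)
shiftAfter-view q y with y ≤ᵇ q in e
... | true = inj₁ (≤ᵇ-true⇒≤ e , refl)
... | false = inj₂ (≤ᵇ-false⇒> e , refl)

shiftAfter-≤ : ∀ {q y} → y ≤ q → shiftAfter q y ≡ y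
shiftAfter-≤ y≤q rewrite ≤⇒≤ᵇ-true y≤q = refl

shiftAfter-> : ∀ {q y} → q < y → shiftAfter q y ≡ suc y
shiftAfter-> q<y rewrite >⇒≤ᵇ-false q<y = refl

shiftAfter-injective : ∀ q y y' → shiftAfter q y ≡ shiftAfter q y' → y ≡ y'
shiftAfter-injective q y y' e with shiftAfter-view q y | shiftAfter-view q y'
... | inj₁ (_ , e₁) | inj₁ (_ , e₂) = trans (sym e₁) (trans e e₂)
... | inj₂ (_ , e₁) | inj₂ (_ , e₂) = suc-injective (trans (sym e₁) (trans e e₂))
... | inj₁ (y≤q , e₁) | inj₂ (q<y' , e₂) =
  ⊥-elim (<⇒≱ q<y' (≤-trans (n≤1+n y') (subst (_≤ q) (trans (sym e₁) (trans e e₂)) y≤q)))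
... | inj₂ (q<y , e₁) | inj₁ (y'≤q , e₂) =
  ⊥-elim (<⇒≱ q<y (≤-trans (n≤1+n y) (subst (_≤ q) (trans (sym e₂) (trans (sym e) e₁)) y'≤q)))

shiftAfter≢suc : ∀ q y → shiftAfter q y ≢ suc q
shiftAfter≢suc q y e with shiftAfter-view q y
... | inj₁ (y≤q , e₁) = <⇒≱ (n<1+n q) (subst (_≤ q) (trans (sym e₁) e) y≤q)
... | inj₂ (q<y , e₁) = <-irrefl (sym (suc-injective (trans (sym e₁) e))) q<y

shiftAfter-< : ∀ q n y → y < n → shiftAfter q y < suc n
shiftAfter-< q n y y<n with shiftAfter-view q y
... | inj₁ (_ , e) rewrite e = m<n⇒m<1+n y<n
... | inj₂ (_ , e) rewrite e = s≤s y<n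

∣m-1+n∣≡1+∣m-n∣ : ∀ m n → m ≤ n → ∣ m - suc n ∣ ≡ suc ∣ m - n ∣
∣m-1+n∣≡1+∣m-n∣ zero n _ = refl
∣m-1+n∣≡1+∣m-n∣ (suc m) (suc n) (s≤s m≤n) = ∣m-1+n∣≡1+∣m-n∣ m n m≤n

cycDist-suc-mono : ∀ n x y x' y' →
  ∣ x' - y' ∣ ≡ ∣ x - y ∣ ⊎ ∣ x' - y' ∣ ≡ suc ∣ x - y ∣ →
  cycDist n x y ≤ cycDist (suc n) x' y'
cycDist-suc-mono n x y x' y' (inj₁ e) rewrite e = ⊓-mono-≤ ≤-refl (∸-monoˡ-≤ ∣ x - y ∣ (n≤1+n n))
cycDist-suc-mono n x y x' y' (inj₂ e) rewrite e = ⊓-mono-≤ (n≤1+n _) ≤-refl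

-- The difference of two positions grows by at most one, and so does the length of the cycle.
cycDist-shiftAfter : ∀ n q x y → cycDist n x y ≤ cycDist (suc n) (shiftAfter q x) (shiftAfter q y)
cycDist-shiftAfter n q x y with shiftAfter-view q x | shiftAfter-view q y
... | inj₁ (_ , ex) | inj₁ (_ , ey) rewrite ex | ey = cycDist-suc-mono n x y x y (inj₁ refl)
... | inj₂ (_ , ex) | inj₂ (_ , ey) rewrite ex | ey = cycDist-suc-mono n x y (suc x) (suc y) (inj₁ refl)
... | inj₁ (x≤q , ex) | inj₂ (q<y , ey) rewrite ex | ey = cycDist-suc-mono n x y x (suc y)
  (inj₂ (∣m-1+n∣≡1+∣m-n∣ x y (≤-trans x≤q (<⇒≤ q<y))))
... | inj₂ (q<x , ex) | inj₁ (y≤q , ey) rewrite ex | ey = cycDist-suc-mono n x y (suc x) y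
  (inj₂ (trans (∣-∣-comm (suc x) y)
    (trans (∣m-1+n∣≡1+∣m-n∣ y x (≤-trans y≤q (<⇒≤ q<x))) (cong suc (∣-∣-comm y x)))))

-- Walks avoiding deleted nodes

module _ {G : Network} {S : List ℕ} where

  walk-snoc : ∀ {a b c} → WalkAvoiding G S a b → adj G b c ≡ true → c < size G → c ∉ S →
    WalkAvoiding G S a c
  walk-snoc here bc c< c∉S = step bc c< c∉S here
  walk-snoc (step ab b< b∉S w) cd d< d∉S = step ab b< b∉S (walk-snoc w cd d< d∉S)

  walk-reverse : (∀ x y → adj G x y ≡ adj G y x) → ∀ {a b} → WalkAvoiding G S a b →
    a < size G → a ∉ S → WalkAvoiding G S b a
  walk-reverse adj-sym here _ _ = here
  walk-reverse adj-sym (step {a} {c} ac c< c∉S w) a< a∉S =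
    walk-snoc (walk-reverse adj-sym w c< c∉S) (trans (adj-sym c a) ac) a< a∉S

search-below : ∀ {P : ℕ → Set} → (∀ t → Dec (P t)) → ∀ n →
  (Σ ℕ λ t → t < n × ¬ P t) ⊎ (∀ t → t < n → P t)
search-below P? zero = inj₂ (λ _ ())
search-below P? (suc n) with search-below P? n
... | inj₁ (t , t<n , ¬Pt) = inj₁ (t , m<n⇒m<1+n t<n , ¬Pt)
... | inj₂ P<n with P? n
...   | no ¬Pn = inj₁ (n , ≤-refl , ¬Pn)
...   | yes Pn = inj₂ P<1+n
  where
  P<1+n : ∀ t → t < suc n → _
  P<1+n t t<1+n with m≤n⇒m<n∨m≡n (≤-pred t<1+n)
  ... | inj₁ t<n = P<n t t<n
  ... | inj₂ refl = Pn

between : ℕ → ℕ → ℕ → Bool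
between i j y = (i <ᵇ y) ∧ (y <ᵇ j)

-- Walk along f 0, f 1, …, f N, where entries at most r apart are linked, jumping to the next
-- surviving entry; a jump can fail only if r consecutive entries are deleted.
module GreedyWalk (G : Network) (S : List ℕ) (r : ℕ) (f g : ℕ → ℕ)
  (f< : ∀ t → t ≤ size G → f t < size G)
  (f-adj : ∀ i d → 0 < d → d ≤ r → i + d ≤ size G → adj G (f i) (f (i + d)) ≡ true)
  (g∘f : ∀ t → t < size G → g (f t) ≡ t) where

  N = size G

  deletedBetween : ℕ → ℕ → ℕ
  deletedBetween i j = count (λ s → between i j (g s)) S

  deletedBetween-monoˡ : ∀ i i' j → i ≤ i' → deletedBetween i' j ≤ deletedBetween i j
  deletedBetween-monoˡ i i' j i≤i' = count-mono _ _ S λ s e →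
    let i'<gs , gs<j = ∧-elim {i' <ᵇ g s} e
    in ∧-intro (<⇒<ᵇ-true (≤-<-trans i≤i' (<ᵇ-true⇒< {i'} {g s} i'<gs))) gs<j

  r≤deletedBetween : ∀ i j → i + r < j → j ≤ N → (∀ t → t < r → f (i + suc t) ∈ S) →
    r ≤ deletedBetween i j
  r≤deletedBetween i j i+r<j j≤N deleted = begin
    r                                                ≡⟨ *-identityʳ r ⟨
    r * 1                                            ≤⟨ *-≤-sumUp _ r 1 hit ⟩
    sumUp (λ t → count (λ s → g s ≡ᵇ suc i + t) S) r ≡⟨ count-inRange g (suc i) r S ⟨
    count (λ s → inRange (suc i) r (g s)) S          ≤⟨ count-mono _ _ S (λ s → inRange⇒between (g s)) ⟩
    deletedBetween i j                               ∎
    where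
    open ≤-Reasoning
    hit : ∀ t → t < r → 1 ≤ count (λ s → g s ≡ᵇ suc i + t) S
    hit t t<r = ∈⇒1≤count _ S (f (i + suc t)) (deleted t t<r)
      (subst (λ z → (z ≡ᵇ suc i + t) ≡ true) (sym (trans (g∘f (i + suc t) i+t<N) (+-suc i t)))
        (≡ᵇ-refl (suc i + t)))
      where
      i+t<N : i + suc t < N
      i+t<N = <-≤-trans (≤-<-trans (+-monoʳ-≤ i t<r) i+r<j) j≤N
    inRange⇒between : ∀ y → inRange (suc i) r y ≡ true → between i j y ≡ true
    inRange⇒between y e = ∧-intro (<⇒<ᵇ-true (inRange⇒≥ (suc i) r y e))
      (<⇒<ᵇ-true (≤-trans (inRange⇒< (suc i) r y e) i+r<j))

  walk-fuel : ∀ k i d j → i + d ≡ j → d ≤ k → j ≤ N → f j ∉ S → deletedBetween i j < r →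
    WalkAvoiding G S (f i) (f j)
  walk-fuel k i zero j refl _ _ _ _ rewrite +-identityʳ i = here
  walk-fuel k i (suc d) j refl _ j≤N fj∉S _ with suc d ≤? r
  ... | yes d<r = step (f-adj i (suc d) z<s d<r j≤N) (f< j j≤N) fj∉S here
  walk-fuel (suc k) i (suc d) j refl (s≤s d≤k) j≤N fj∉S few | no d≮r
    with search-below (λ t → f (i + suc t) ∈? S) r
  ... | inj₁ (t , t<r , f∉S) =
        step (f-adj i (suc t) z<s t<r i+t≤N) (f< (i + suc t) i+t≤N) f∉S
          (walk-fuel k (i + suc t) (suc d ∸ suc t) j i+t+[d∸t]≡j (≤-trans (m∸n≤m d t) d≤k)
            j≤N fj∉S
            (≤-<-trans (deletedBetween-monoˡ i (i + suc t) j (m≤m+n i (suc t))) few))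
    where
    t≤d : suc t ≤ suc d
    t≤d = ≤-trans t<r (<⇒≤ (≰⇒> d≮r))
    i+t+[d∸t]≡j : i + suc t + (suc d ∸ suc t) ≡ i + suc d
    i+t+[d∸t]≡j = trans (+-assoc i (suc t) _) (cong (i +_) (m+[n∸m]≡n t≤d))
    i+t≤N : i + suc t ≤ N
    i+t≤N = ≤-trans (+-monoʳ-≤ i t≤d) j≤N
  ... | inj₂ all∈S = ⊥-elim (<⇒≱ few
        (r≤deletedBetween i (i + suc d) (+-monoʳ-< i (≰⇒> d≮r)) j≤N all∈S))

  walk-along : ∀ i j → i ≤ j → j ≤ N → f j ∉ S → deletedBetween i j < r →
    WalkAvoiding G S (f i) (f j)
  walk-along i j i≤j = walk-fuel (j ∸ i) i (j ∸ i) j (m+[n∸m]≡n i≤j) ≤-refl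

-- The invariant of the construction

record Invariant (Nf : ℕ) (s : State) : Set where
  field
    pos<          : ∀ v → v < size (net s) → pos s v < size (net s)
    pos-injective : ∀ v w → v < size (net s) → w < size (net s) → pos s v ≡ pos s w → v ≡ w
    node          : ℕ → ℕ
    node<         : ∀ p → p < size (net s) → node p < size (net s)
    pos∘node      : ∀ p → p < size (net s) → pos s (node p) ≡ p
    adj⇒<         : ∀ a b → adj (net s) a b ≡ true → a < size (net s)
    adj-sym       : ∀ a b → adj (net s) a b ≡ adj (net s) b a
    near⇒adj      : ∀ a b → a < size (net s) → b < size (net s) → a ≢ b →
                    cycDist (size (net s)) (pos s a) (pos s b) ≤ radius Nf → adj (net s) a b ≡ true

invariant-initial : ∀ Nf N1 → Invariant Nf (initial Nf N1)
invariant-initial Nf N1 = record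
  { pos<          = λ _ v< → v<
  ; pos-injective = λ _ _ _ _ e → e
  ; node          = λ p → p
  ; node<         = λ _ p< → p<
  ; pos∘node      = λ _ _ → refl
  ; adj⇒<         = λ a b e → <ᵇ-true⇒< (proj₁ (∧-elim {a <ᵇ N1} e))
  ; adj-sym       = adj-sym
  ; near⇒adj      = λ a b a< b< a≢b near → ∧-intro (<⇒<ᵇ-true a<) (∧-intro (<⇒<ᵇ-true b<)
                      (∧-intro (cong not (≢⇒≡ᵇ-false a≢b)) (≤⇒≤ᵇ-true near)))
  }
  where
  adj-sym : ∀ a b → adj (net (initial Nf N1)) a b ≡ adj (net (initial Nf N1)) b a
  adj-sym a b rewrite ≡ᵇ-sym a b | cycDist-sym N1 a b with a <ᵇ N1 | b <ᵇ N1
  ... | true | true = refl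
  ... | true | false = refl
  ... | false | true = refl
  ... | false | false = refl

linkCount-initial : ∀ Nf N1 → radius Nf ≤ N1 →
  linkCount (net (initial Nf N1)) ≤ N1 * (radius Nf + radius Nf)
linkCount-initial Nf N1 r≤N1 = sumUp-≤-* _ N1 _ λ b b<N1 →
  ≤-trans (sumUp-mono _ _ b (λ a a<b → indicator-mono (λ e →
     proj₂ (∧-elim {not (a ≡ᵇ b)} (proj₂ (∧-elim {b <ᵇ N1} (proj₂ (∧-elim {a <ᵇ N1} e))))))))
    (near-count≤2r N1 (radius Nf) b (λ a → a) b b<N1 r≤N1 (λ a a<b → <-trans a<b b<N1)
      (λ _ _ _ _ e → e) (λ a a<b → <⇒≢ a<b))

data Around (q : ℕ) : ℕ → Set where
  before : ∀ {x} → x ≤ q → Around q x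
  at     : Around q (suc q)
  after  : ∀ {x} → q < x → Around q (suc x)

around : ∀ q x → Around q x
around q x with x ≤? q
... | yes x≤q = before x≤q
... | no x≰q with ≰⇒> x≰q
...   | s≤s {n = x'} q≤x' with m≤n⇒m<n∨m≡n q≤x'
...     | inj₁ q<x' = after q<x'
...     | inj₂ refl = at

data NewOrOld (n : ℕ) : ℕ → Set where
  new : NewOrOld n n
  old : ∀ {v} → v < n → NewOrOld n v

newOrOld : ∀ {n v} → v < suc n → NewOrOld n v
newOrOld v<1+n with m≤n⇒m<n∨m≡n (≤-pred v<1+n)
... | inj₁ v<n = old v<n
... | inj₂ refl = new

-- linkCount G is definitionally sumUp (lowerDegree G) (size G).
lowerDegree : Network → ℕ → ℕ
lowerDegree G b = sumUp (λ a → indicator (adj G a b)) b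

module Grow (Nf : ℕ) (s : State) (p : Fin (size (net s))) (inv : Invariant Nf s) where
  open Invariant inv
  private
    n = size (net s)
    q = toℕ p
    q<n : q < n
    q<n = toℕ<n p
    s' = grow Nf s p
    r = radius Nf

  pos-new : pos s' n ≡ suc q
  pos-new rewrite ≡ᵇ-refl n = refl

  pos-old : ∀ {v} → v < n → pos s' v ≡ shiftAfter q (pos s v)
  pos-old {v} v<n rewrite ≢⇒≡ᵇ-false (<⇒≢ v<n) = refl

  pos'< : ∀ v → v < suc n → pos s' v < suc n
  pos'< v v< with newOrOld v<
  ... | new rewrite pos-new = s≤s q<n
  ... | old v<n rewrite pos-old v<n = shiftAfter-< q n (pos s v) (pos< v v<n)

  pos'-old≢new : ∀ {v} → v < n → pos s' v ≢ pos s' n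
  pos'-old≢new {v} v<n rewrite pos-old v<n | pos-new = shiftAfter≢suc q (pos s v)

  pos'-injective : ∀ v w → v < suc n → w < suc n → pos s' v ≡ pos s' w → v ≡ w
  pos'-injective v w v< w< e with newOrOld v< | newOrOld w<
  ... | new | new = refl
  ... | new | old w<n = ⊥-elim (pos'-old≢new w<n (sym e))
  ... | old v<n | new = ⊥-elim (pos'-old≢new v<n e)
  ... | old v<n | old w<n rewrite pos-old v<n | pos-old w<n =
    pos-injective v w v<n w<n (shiftAfter-injective q (pos s v) (pos s w) e)

  node' : ℕ → ℕ
  node' x = if x ≡ᵇ suc q then n else (if x ≤ᵇ q then node x else node (x ∸ 1))

  node'-before : ∀ {x} → x ≤ q → node' x ≡ node x
  node'-before x≤q rewrite ≢⇒≡ᵇ-false (<⇒≢ (s≤s x≤q)) | ≤⇒≤ᵇ-true x≤q = refl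

  node'-at : node' (suc q) ≡ n
  node'-at rewrite ≡ᵇ-refl q = refl

  node'-after : ∀ {x} → q < x → node' (suc x) ≡ node x
  node'-after {x} q<x
    rewrite ≢⇒≡ᵇ-false (<⇒≢ q<x ∘′ sym ∘′ suc-injective) | >⇒≤ᵇ-false (m<n⇒m<1+n q<x) = refl

  node'< : ∀ x → x < suc n → node' x < suc n
  node'< x x< with around q x
  ... | before x≤q rewrite node'-before x≤q = m<n⇒m<1+n (node< x (≤-<-trans x≤q q<n))
  ... | at rewrite node'-at = n<1+n n
  ... | after {x'} q<x' rewrite node'-after q<x' = m<n⇒m<1+n (node< x' (≤-pred x<))

  pos∘node' : ∀ x → x < suc n → pos s' (node' x) ≡ x
  pos∘node' x x< with around q x
  ... | before x≤q
    rewrite node'-before x≤q | pos-old (node< x (≤-<-trans x≤q q<n)) | pos∘node x (≤-<-trans x≤q q<n) =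
    shiftAfter-≤ x≤q
  ... | at rewrite node'-at = pos-new
  ... | after {x'} q<x'
    rewrite node'-after q<x' | pos-old (node< x' (≤-pred x<)) | pos∘node x' (≤-pred x<) =
    shiftAfter-> q<x'

  adj'⇒< : ∀ a b → adj (net s') a b ≡ true → a < suc n
  adj'⇒< a b e with ∨-elim {adj (net s) a b} e
  ... | inj₁ old-link = m<n⇒m<1+n (adj⇒< a b old-link)
  ... | inj₂ new-link with ∨-elim {(a ≡ᵇ n) ∧ _} new-link
  ...   | inj₁ a-new = ≤-reflexive (cong suc (≡ᵇ-true⇒≡ (proj₁ (∧-elim {a ≡ᵇ n} a-new))))
  ...   | inj₂ b-new =
    m<n⇒m<1+n (<ᵇ-true⇒< (proj₁ (∧-elim {a <ᵇ n} (proj₂ (∧-elim {b ≡ᵇ n} b-new)))))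

  adj'-sym : ∀ a b → adj (net s') a b ≡ adj (net s') b a
  adj'-sym a b rewrite adj-sym a b | cycDist-sym (suc n) (pos s' a) (pos s' b) =
    cong (adj (net s) b a ∨_)
      (∨-comm ((a ≡ᵇ n) ∧ (b <ᵇ n) ∧ within Nf (suc n) (pos s' b) (pos s' a))
              ((b ≡ᵇ n) ∧ (a <ᵇ n) ∧ within Nf (suc n) (pos s' b) (pos s' a)))

  near⇒adj' : ∀ a b → a < suc n → b < suc n → a ≢ b →
    cycDist (suc n) (pos s' a) (pos s' b) ≤ r → adj (net s') a b ≡ true
  near⇒adj' a b a< b< a≢b near with newOrOld a< | newOrOld b<
  ... | new | new = ⊥-elim (a≢b refl)
  ... | new | old b<n = ∨-introʳ (adj (net s) n b) (∨-introˡ _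
        (∧-intro (≡ᵇ-refl n) (∧-intro (<⇒<ᵇ-true b<n) (≤⇒≤ᵇ-true near))))
  ... | old a<n | new = ∨-introʳ (adj (net s) a n) (∨-introʳ _
        (∧-intro (≡ᵇ-refl n) (∧-intro (<⇒<ᵇ-true a<n) (≤⇒≤ᵇ-true near))))
  ... | old a<n | old b<n = ∨-introˡ _ (near⇒adj a b a<n b<n a≢b
        (≤-trans (cycDist-shiftAfter n q (pos s a) (pos s b))
          (subst₂ (λ u v → cycDist (suc n) u v ≤ r) (pos-old a<n) (pos-old b<n) near)))

  invariant-grow : Invariant Nf s'
  invariant-grow = record
    { pos< = pos'< ; pos-injective = pos'-injective ; node = node' ; node< = node'<
    ; pos∘node = pos∘node' ; adj⇒< = adj'⇒< ; adj-sym = adj'-sym ; near⇒adj = near⇒adj' }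

  grow-subnetwork : Subnetwork (net s) (net s')
  grow-subnetwork = n≤1+n n , λ a b _ _ e → ∨-introˡ _ e

  adj'-old : ∀ {a b} → a < n → b < n → adj (net s') a b ≡ adj (net s) a b
  adj'-old a<n b<n rewrite ≢⇒≡ᵇ-false (<⇒≢ a<n) | ≢⇒≡ᵇ-false (<⇒≢ b<n) = ∨-identityʳ _

  adj'-new⇒near : ∀ a → a < n → adj (net s') a n ≡ true →
    (cycDist (suc n) (pos s' a) (suc q) ≤ᵇ r) ≡ true
  adj'-new⇒near a a<n e with ∨-elim {adj (net s) a n} e
  ... | inj₁ old-link = ⊥-elim (<-irrefl refl (adj⇒< n a (trans (adj-sym n a) old-link)))
  ... | inj₂ new-link with ∨-elim {(a ≡ᵇ n) ∧ _} new-link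
  ...   | inj₁ a-new = ⊥-elim (<⇒≢ a<n (≡ᵇ-true⇒≡ (proj₁ (∧-elim {a ≡ᵇ n} a-new))))
  ...   | inj₂ n-new = subst (λ z → (cycDist (suc n) (pos s' a) z ≤ᵇ r) ≡ true) pos-new
          (proj₂ (∧-elim {a <ᵇ n} (proj₂ (∧-elim {n ≡ᵇ n} n-new))))

  lowerDegree-new≤2r : r ≤ suc n → lowerDegree (net s') n ≤ r + r
  lowerDegree-new≤2r r≤1+n = ≤-trans (sumUp-mono _ _ n (λ a a<n → indicator-mono (adj'-new⇒near a a<n)))
    (near-count≤2r (suc n) r (suc q) (pos s') n (s≤s q<n) r≤1+n
      (λ a a<n → pos'< a (m<n⇒m<1+n a<n))
      (λ a a' a<n a'<n → pos'-injective a a' (m<n⇒m<1+n a<n) (m<n⇒m<1+n a'<n))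
      (λ a a<n e → pos'-old≢new a<n (trans e (sym pos-new))))

  linkCount-grow : r ≤ suc n → linkCount (net s') ≤ linkCount (net s) + (r + r)
  linkCount-grow r≤1+n = begin
    sumUp (lowerDegree (net s')) (suc n)                   ≡⟨ sumUp-suc (lowerDegree (net s')) n ⟩
    sumUp (lowerDegree (net s')) n + lowerDegree (net s') n ≡⟨ cong (_+ lowerDegree (net s') n) old-columns ⟩
    sumUp (lowerDegree (net s)) n + lowerDegree (net s') n  ≤⟨ +-monoʳ-≤ _ (lowerDegree-new≤2r r≤1+n) ⟩
    linkCount (net s) + (r + r)                             ∎
    where
    open ≤-Reasoning
    old-columns : sumUp (lowerDegree (net s')) n ≡ sumUp (lowerDegree (net s)) n
    old-columns = sumUp-cong _ _ n (λ b b<n → sumUp-cong _ _ b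
      (λ a a<b → cong indicator (adj'-old (<-trans a<b b<n) b<n)))

-- Robustness

module _ {Nf : ℕ} {s : State} (inv : Invariant Nf s) where
  open Invariant inv
  private
    N = size (net s)
    r = radius Nf

  node∘pos : ∀ v → v < N → node (pos s v) ≡ v
  node∘pos v v< = pos-injective _ v (node< _ (pos< v v<)) v< (pos∘node _ (pos< v v<))

  module CycleFrom (S : List ℕ) (a : ℕ) (a< : a < N) (r<N : r < N) where
    x = pos s a
    x<N = pos< a a<

    f : ℕ → ℕ
    f t = node (wrap N (x + t))

    g : ℕ → ℕ
    g v = offset N x (pos s v)

    pos∘f : ∀ t → t ≤ N → pos s (f t) ≡ wrap N (x + t)
    pos∘f t t≤N = pos∘node _ (wrap-+< N x t x<N t≤N)

    f< : ∀ t → t ≤ N → f t < N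
    f< t t≤N = node< _ (wrap-+< N x t x<N t≤N)

    f-adj : ∀ i d → 0 < d → d ≤ r → i + d ≤ N → adj (net s) (f i) (f (i + d)) ≡ true
    f-adj i d 0<d d≤r i+d≤N with wrap-near N r x i d x<N 0<d d≤r r<N
    ... | distinct , near = near⇒adj (f i) (f (i + d)) (f< i i≤N) (f< (i + d) i+d≤N)
          (λ e → distinct (trans (sym (pos∘f i i≤N)) (trans (cong (pos s) e) (pos∘f (i + d) i+d≤N))))
          (subst₂ (λ u v → cycDist N u v ≤ r) (sym (pos∘f i i≤N)) (sym (pos∘f (i + d) i+d≤N)) near)
      where
      i≤N : i ≤ N
      i≤N = ≤-trans (m≤m+n i d) i+d≤N

    g∘f : ∀ t → t < N → g (f t) ≡ t
    g∘f t t<N rewrite pos∘f t (<⇒≤ t<N) = offset-wrap N x t x<N t<N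

    f∘g : ∀ v → v < N → f (g v) ≡ v
    f∘g v v< rewrite wrap-offset N x (pos s v) x<N (pos< v v<) = node∘pos v v<

    f-0 : f 0 ≡ a
    f-0 rewrite +-identityʳ x | wrap-< x<N = node∘pos a a<

    f-N : f N ≡ a
    f-N rewrite wrap-≥ (m≤n+m N x) | m+n∸n≡m x N = node∘pos a a<

    g< : ∀ v → v < N → g v < N
    g< v v< = offset< N x (pos s v) x<N (pos< v v<)

    open GreedyWalk (net s) S r f g f< f-adj g∘f public using (deletedBetween; walk-along)

  robust : suc Nf ≡ r + r → r < N → Robust Nf (net s)
  robust 1+Nf≡2r r<N S _ |S|≡Nf _ a b a< b< a∉S b∉S = [ forward , backward ]′ one-arc-sparse
    where
    open CycleFrom S a a< r<N
    d = g b
    d<N = g< b b<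
    disjoint : ∀ y → between 0 d y ≡ true → between d N y ≡ false
    disjoint y e
      rewrite ≥⇒<ᵇ-false {d} {y} (<⇒≤ (<ᵇ-true⇒< {y} (proj₂ (∧-elim {0 <ᵇ y} e)))) = refl
    one-arc-sparse : deletedBetween 0 d < r ⊎ deletedBetween d N < r
    one-arc-sparse = +<2*⇒⊎ (begin-strict
      deletedBetween 0 d + deletedBetween d N
        ≤⟨ count-disjoint≤length _ _ S (λ v → disjoint (g v)) ⟩
      length S ≡⟨ |S|≡Nf ⟩
      Nf <⟨ n<1+n Nf ⟩
      suc Nf ≡⟨ 1+Nf≡2r ⟩
      r + r ∎)
      where open ≤-Reasoning
    forward : deletedBetween 0 d < r → WalkAvoiding (net s) S a b
    forward sparse = subst₂ (WalkAvoiding (net s) S) f-0 (f∘g b b<)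
      (walk-along 0 d z≤n (<⇒≤ d<N) (subst (_∉ S) (sym (f∘g b b<)) b∉S) sparse)
    backward : deletedBetween d N < r → WalkAvoiding (net s) S a b
    backward sparse = walk-reverse adj-sym (subst₂ (WalkAvoiding (net s) S) (f∘g b b<) f-N
      (walk-along d N (<⇒≤ d<N) ≤-refl (subst (_∉ S) (sym f-N) a∉S) sparse)) b< b∉S

subnetwork-refl : ∀ {H} → Subnetwork H H
subnetwork-refl = ≤-refl , λ _ _ _ _ e → e

subnetwork-trans : ∀ {A B C} → Subnetwork A B → Subnetwork B C → Subnetwork A C
subnetwork-trans (A≤B , A⊆B) (B≤C , B⊆C) = ≤-trans A≤B B≤C ,
  λ a b a< b< e → B⊆C a b (<-≤-trans a< A≤B) (<-≤-trans b< A≤B) (A⊆B a b a< b< e)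

subnetwork-chain : (H : ℕ → Network) → (∀ k → Subnetwork (H k) (H (suc k))) →
  ∀ {i j} → i ≤′ j → Subnetwork (H i) (H j)
subnetwork-chain H H⊆H' ≤′-refl = subnetwork-refl
subnetwork-chain H H⊆H' (≤′-step i≤′j) = subnetwork-trans (subnetwork-chain H H⊆H' i≤′j) (H⊆H' _)

radius-odd : ∀ m → radius (2 * m + 1) ≡ suc m
radius-odd m = trans (cong (_/ 2) 2+2m≡[1+m]*2) (m*n/n≡m (suc m) 2)
  where
  2+2m≡[1+m]*2 : suc (2 * m + 1) ≡ suc m * 2
  2+2m≡[1+m]*2 rewrite *-comm (suc m) 2 | +-suc m (m + 0) | +-comm (m + (m + 0)) 1 = refl

module _ (Nf N1 : ℕ) (ins : (k : ℕ) → Fin (N1 + k)) where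
  private
    state = construction Nf N1 ins
    r = radius Nf

  size-G : ∀ k → size (G Nf N1 ins k) ≡ N1 + k
  size-G k = sym (sizeEq Nf N1 ins k)

  invariant-construction : ∀ k → Invariant Nf (state k)
  invariant-construction zero = invariant-initial Nf N1
  invariant-construction (suc k) =
    Grow.invariant-grow Nf (state k) (castIns Nf N1 ins k) (invariant-construction k)

  G-subnetwork-suc : ∀ k → Subnetwork (G Nf N1 ins k) (G Nf N1 ins (suc k))
  G-subnetwork-suc k = Grow.grow-subnetwork Nf (state k) (castIns Nf N1 ins k) (invariant-construction k)

  linkCount-G : (∀ k → r < N1 + k) → ∀ k → linkCount (G Nf N1 ins k) ≤ (N1 + k) * (r + r)
  linkCount-G r<N zero rewrite +-identityʳ N1 =
    linkCount-initial Nf N1 (<⇒≤ (subst (r <_) (+-identityʳ N1) (r<N 0)))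
  linkCount-G r<N (suc k) = begin
    linkCount (G Nf N1 ins (suc k))
      ≤⟨ Grow.linkCount-grow Nf (state k) (castIns Nf N1 ins k) (invariant-construction k)
           (<⇒≤ (subst (r <_) (sym (size-G (suc k))) (r<N (suc k)))) ⟩
    linkCount (G Nf N1 ins k) + (r + r) ≤⟨ +-monoˡ-≤ (r + r) (linkCount-G r<N k) ⟩
    (N1 + k) * (r + r) + (r + r)        ≡⟨ +-comm ((N1 + k) * (r + r)) (r + r) ⟩
    suc (N1 + k) * (r + r)              ≡⟨ cong (_* (r + r)) (+-suc N1 k) ⟨
    (N1 + suc k) * (r + r)              ∎
    where open ≤-Reasoning

theorem5 : (Nf N1 : ℕ) → Odd Nf →
    (∀ k → Nf < (N1 + k) ∸ 2) →
    (ins : (k : ℕ) → Fin (N1 + k)) →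
    (∀ i j → i ≤ j → Subnetwork (G Nf N1 ins i) (G Nf N1 ins j)) ×
    (∀ k → Robust Nf (G Nf N1 ins k)) ×
    (∀ k → linkCount (G Nf N1 ins k) ≤ (N1 + k) * (Nf + 1))
theorem5 _ N1 (m , refl) Nf<N∸2 ins =
    (λ i j i≤j → subnetwork-chain (G Nf N1 ins) (G-subnetwork-suc Nf N1 ins) (≤⇒≤′ i≤j))
  , (λ k → robust (invariant-construction Nf N1 ins k) 1+Nf≡2r
             (subst (r <_) (sym (size-G Nf N1 ins k)) (r<N k)))
  , (λ k → subst (λ c → linkCount (G Nf N1 ins k) ≤ (N1 + k) * c) 2r≡Nf+1 (linkCount-G Nf N1 ins r<N k))
  where
  Nf = 2 * m + 1
  r = radius Nf
  1+Nf≡2r : suc Nf ≡ r + r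
  1+Nf≡2r rewrite radius-odd m | +-identityʳ m | +-suc m m | +-comm (m + m) 1 = refl
  2r≡Nf+1 : r + r ≡ Nf + 1
  2r≡Nf+1 = trans (sym 1+Nf≡2r) (+-comm 1 Nf)
  r<N : ∀ k → r < N1 + k
  r<N k = ≤-<-trans r≤Nf (<-≤-trans (Nf<N∸2 k) (m∸n≤m (N1 + k) 2))
    where
    r≤Nf : r ≤ Nf
    r≤Nf rewrite radius-odd m | +-comm (2 * m) 1 = s≤s (m≤m+n m (m + 0))
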